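{- Let $H$ be a connected subgraph of $G_{nbd}$. Then $C[\mathsf{sp}(H)]$ is connected.
   Context: Graphs are finite and simple. A hole is an induced cycle of length at least $4$; a graph is chordal if it has no hole. Let $s_k=4k(\log k+\log\log k+4)$ for $k\ge2$, $s_1=2$, and $\mu_k=76s_{k+1}+3217k+1985$. Standing assumptions: $G$ is a graph, $k$ a positive integer, $C$ a shortest hole of $G$ of length strictly greater than $\mu_k$, and $G-V(C)$ is chordal. $D$ is the set of vertices of $G$ adjacent to every vertex of $C$; $G_{nbd}=G[N[V(C)]\setminus D]$ where $N[V(C)]$ is the closed neighborhood of $V(C)$. For $v\in V(C)$, $Z_v=\{v\}\cup(N(v)\setminus V(C)\setminus D)$. For a subgraph $H$ of $G$, $\mathsf{sp}(H)$ is the set of $v\in V(C)$ with $(Z_v\cup D)\cap V(H)\neq\emptyset$. -}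

module Defs where

open import Data.Nat as ℕ using (ℕ; zero; suc; _≤_; _<_; _%_)
open import Data.Integer as ℤ using (ℤ; +_)
open import Data.Rational as ℚ using (ℚ; _/_)
open import Data.Fin using (Fin; toℕ)
open import Data.Bool using (Bool; true; false)
open import Data.Product using (Σ; ∃; _×_; _,_)
open import Data.Sum using (_⊎_)
open import Data.Empty using (⊥)
open import Relation.Nullary using (¬_)
open import Relation.Binary.PropositionalEquality using (_≡_)
open import Function.Bundles using (_⇔_)

record Graph (n : ℕ) : Set where
  field
    adj   : Fin n → Fin n → Bool
    sym   : ∀ u v → adj u v ≡ adj v u
    irrfl : ∀ v → adj v v ≡ false

open Graph public

Adj : ∀ {n} → Graph n → Fin n → Fin n → Set
Adj G u v = adj G u v ≡ true

data Reach {X : Set} (V : X → Set) (E : X → X → Set) : X → X → Set where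
  here  : ∀ {x} → Reach V E x x
  there : ∀ {x y z} → E x y → V y → Reach V E y z → Reach V E x z

Connected : {X : Set} → (X → Set) → (X → X → Set) → Set
Connected {X} V E = (∃ λ x → V x) × (∀ x y → V x → V y → Reach V E x y)

-- Cycles.  A cycle of length L is given by an injective map
-- c : Fin L → Fin n; c i and c j are consecutive on the cycle iff
-- j ≡ i + 1 (mod L) or i ≡ j + 1 (mod L).

CycNext : ∀ {L} → Fin L → Fin L → Set
CycNext {L} i j = (toℕ j ≡ suc (toℕ i)) ⊎ ((suc (toℕ i) ≡ L) × (toℕ j ≡ 0))

CycAdj : ∀ {L} → Fin L → Fin L → Set
CycAdj i j = CycNext i j ⊎ CycNext j i

IsHole : ∀ {n} → Graph n → (L : ℕ) → (Fin L → Fin n) → Set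
IsHole G L c =
  (4 ≤ L) ×
  (∀ i j → c i ≡ c j → i ≡ j) ×
  (∀ i j → Adj G (c i) (c j) ⇔ CycAdj i j)

IsShortestHole : ∀ {n} → Graph n → (L : ℕ) → (Fin L → Fin n) → Set
IsShortestHole {n} G L c =
  IsHole G L c × (∀ (L′ : ℕ) (c′ : Fin L′ → Fin n) → IsHole G L′ c′ → L ≤ L′)

InC : ∀ {n L} → (Fin L → Fin n) → Fin n → Set
InC {L = L} c v = Σ (Fin L) λ i → c i ≡ v

-- G - V(C) is chordal: G has no hole avoiding V(C)
-- (the holes of G - V(C) are exactly the holes of G avoiding V(C)).
ChordalMinus : ∀ {n L} → Graph n → (Fin L → Fin n) → Set
ChordalMinus {n} G c =
  ∀ (L′ : ℕ) (c′ : Fin L′ → Fin n) → IsHole G L′ c′ → (∀ i → ¬ InC c (c′ i)) → ⊥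

InD : ∀ {n L} → Graph n → (Fin L → Fin n) → Fin n → Set
InD G c v = ∀ i → Adj G v (c i)

InClosedNbd : ∀ {n L} → Graph n → (Fin L → Fin n) → Fin n → Set
InClosedNbd {L = L} G c v = InC c v ⊎ Σ (Fin L) λ i → Adj G v (c i)

InGnbd : ∀ {n L} → Graph n → (Fin L → Fin n) → Fin n → Set
InGnbd G c v = InClosedNbd G c v × ¬ InD G c v

InZ : ∀ {n L} → Graph n → (Fin L → Fin n) → Fin L → Fin n → Set
InZ G c i u = (u ≡ c i) ⊎ (Adj G (c i) u × ¬ InC c u × ¬ InD G c u)

-- A subgraph H of G_nbd: vertex set VH, edge set EH (symmetric),
-- every vertex of H is a vertex of G_nbd, every edge of H is an edge of G
-- (hence of the induced subgraph G_nbd) between vertices of H.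
record SubgraphOfGnbd {n L} (G : Graph n) (c : Fin L → Fin n) : Set where
  field
    VH     : Fin n → Bool
    EH     : Fin n → Fin n → Bool
    V⊆     : ∀ v → VH v ≡ true → InGnbd G c v
    E⊆     : ∀ u v → EH u v ≡ true → Adj G u v × VH u ≡ true × VH v ≡ true
    EH-sym : ∀ u v → EH u v ≡ EH v u

open SubgraphOfGnbd public

IsConnectedSub : ∀ {n L} {G : Graph n} {c : Fin L → Fin n} → SubgraphOfGnbd G c → Set
IsConnectedSub H = Connected (λ v → VH H v ≡ true) (λ u v → EH H u v ≡ true)

InSp : ∀ {n L} (G : Graph n) (c : Fin L → Fin n) → SubgraphOfGnbd G c → Fin L → Set
InSp {n} G c H i = Σ (Fin n) λ u → (VH H u ≡ true) × (InZ G c i u ⊎ InD G c u)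

-- C[sp(H)] is connected (C is induced, so its edges are the cycle edges)
SpConnected : ∀ {n L} (G : Graph n) (c : Fin L → Fin n) → SubgraphOfGnbd G c → Set
SpConnected G c H = Connected (InSp G c H) CycAdj

-- The threshold μ_k = 76 s_{k+1} + 3217 k + 1985, with
-- s_m = 4 m (ln m + ln ln m + 4) for m ≥ 2 (natural logarithm).

pow : ℚ → ℕ → ℚ
pow q zero    = ℚ.1ℚ
pow q (suc m) = q ℚ.* pow q m

fromℕ : ℕ → ℚ
fromℕ m = (+ m) / 1

-- ExpGt x q  ⇔  q < e^x .
-- Uses that (1 + x/N)^N increases strictly to e^x for N > max(0, -x).
ExpGt : ℚ → ℚ → Set
ExpGt x q = Σ ℕ λ N →
  (ℚ.0ℚ ℚ.< fromℕ (suc N) ℚ.+ x) ×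
  (q ℚ.< pow (ℚ.1ℚ ℚ.+ x ℚ.* ((+ 1) / suc N)) (suc N))

-- MuLt k N  ⇔  μ_k < N.
-- With m = k+1, a = N - 3217k - 1985 and B = a/(304 m) - 4:
--   μ_k < N ⇔ B > ln(m ln m) ⇔ m < exp(e^B / m)
--           ⇔ ∃ rational t. m < e^t and m t < e^B.
MuLt : ℕ → ℕ → Set
MuLt k N = Σ ℚ λ t → ExpGt t (fromℕ (suc k)) × ExpGt B (fromℕ (suc k) ℚ.* t)
  where
  a : ℤ
  a = + N ℤ.- + (3217 ℕ.* k ℕ.+ 1985)
  B : ℚ
  B = (a / (304 ℕ.* suc k)) ℚ.- fromℕ 4

module Submission where

-- The latter follows from μ_k < L (module Threshold, by
-- estimating the rational approximants (1 + x/N)^N of e^x).  Positions on C are then read as natural numbers modulo L.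
--
-- A vertex u outside C that sees (is adjacent to) positions y and y + d but none in
-- between closes a hole of length d + 2 with that arc of C (module Detour), so the
-- positions seen by u form an arc of C.  If two adjacent vertices u, v outside C saw
-- neither a common nor two consecutive positions, clean arcs from u to v and back
-- would close holes of lengths d + 3 and d′ + 3 with d + d′ ≤ L, forcing L ≤ 6.
-- Hence the Z-sets containing one vertex of H span a walk in C[sp(H)], the ends of an
-- edge of H lie in Z-sets at equal or adjacent positions, and every walk in H lifts to
-- a walk in C[sp(H)]; since H avoids D, sp(H) is spanned by such Z-sets.

open import Defs renaming (sym to adj-sym)

module Threshold where

  open import Data.Nat as ℕ using (ℕ; zero; suc; s≤s; z≤n)
  import Data.Nat.Properties as ℕ
  open import Data.Nat.Tactic.RingSolver using (solve-∀)
  open import Data.Integer as ℤ using (+_)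
  import Data.Integer.Properties as ℤ
  open import Data.Rational using (ℚ; _/_; 0ℚ; 1ℚ; _+_; _*_; -_; _-_; _≤_; _<_; _≤?_; _<?_; toℚᵘ; nonNegative)
  open import Data.Rational.Properties
  import Data.Rational.Unnormalised as U
  import Data.Rational.Unnormalised.Properties as U
  open import Data.Rational.Solver using (module +-*-Solver)
  open import Data.Product using (_,_)
  open import Data.Sum using (inj₁; inj₂)
  open import Data.Empty using (⊥; ⊥-elim)
  open import Relation.Nullary using (yes; no)
  open import Relation.Nullary.Decidable using (toWitness)
  open import Relation.Binary.PropositionalEquality using (_≡_; refl; sym; trans; cong; subst; subst₂)

  -- the step size 1/(N+1) of the approximation (1 + x/(N+1))^(N+1) of e^x
  step : ℕ → ℚ
  step N = (+ 1) / suc N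

  toℚᵘ-/ : ∀ i n → toℚᵘ (i / suc n) U.≃ U.mkℚᵘ i n
  toℚᵘ-/ i n = toℚᵘ-fromℚᵘ (U.mkℚᵘ i n)

  fromℕ-suc : ∀ m → fromℕ (suc m) ≡ 1ℚ + fromℕ m
  fromℕ-suc m = toℚᵘ-injective (U.≃-trans (toℚᵘ-/ (+ suc m) 0)
    (U.≃-trans (U.*≡* (lemma m))
      (U.≃-sym (U.≃-trans (toℚᵘ-homo-+ 1ℚ (fromℕ m)) (U.+-cong (U.≃-refl {U.1ℚᵘ}) (toℚᵘ-/ (+ m) 0))))))
    where
    lemma : ∀ m → + suc m ℤ.* U.↧ (U.1ℚᵘ U.+ U.mkℚᵘ (+ m) 0) ≡ U.↥ (U.1ℚᵘ U.+ U.mkℚᵘ (+ m) 0) ℤ.* + 1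
    lemma zero = refl
    lemma (suc m) rewrite ℕ.*-identityʳ m = cong (λ z → + suc (suc z)) (sym (ℕ.*-identityʳ m))

  fromℕ-nonNeg : ∀ m → 0ℚ ≤ fromℕ m
  fromℕ-nonNeg m = nonNegative⁻¹ (fromℕ m) {{normalize-nonNeg m 1}}

  fromℕ-mono-≤ : ∀ {m n} → m ℕ.≤ n → fromℕ m ≤ fromℕ n
  fromℕ-mono-≤ {n = n} z≤n = fromℕ-nonNeg n
  fromℕ-mono-≤ {suc m} {suc n} (s≤s m≤n) =
    subst₂ _≤_ (sym (fromℕ-suc m)) (sym (fromℕ-suc n)) (+-monoʳ-≤ 1ℚ (fromℕ-mono-≤ m≤n))

  step-nonNeg : ∀ N → 0ℚ ≤ step N
  step-nonNeg N = nonNegative⁻¹ (step N) {{normalize-nonNeg 1 (suc N)}}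

  fromℕ*step : ∀ N → fromℕ (suc N) * step N ≡ 1ℚ
  fromℕ*step N = toℚᵘ-injective (U.≃-trans (toℚᵘ-homo-* (fromℕ (suc N)) (step N))
    (U.≃-trans (U.*-cong (toℚᵘ-/ (+ suc N) 0) (toℚᵘ-/ (+ 1) N)) (U.*≡* (cong (λ z → + suc z) (lemma N)))))
    where
    lemma : ∀ N → N ℕ.* 1 ℕ.* 1 ≡ N ℕ.+ 0 ℕ.* suc N ℕ.+ 0 ℕ.* suc (N ℕ.+ 0 ℕ.* suc N)
    lemma = solve-∀

  *-monoˡ-≤-≥0 : ∀ r {p q} → 0ℚ ≤ r → p ≤ q → r * p ≤ r * q
  *-monoˡ-≤-≥0 r r≥0 = *-monoˡ-≤-nonNeg r {{nonNegative r≥0}}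

  *-monoʳ-≤-≥0 : ∀ r {p q} → 0ℚ ≤ r → p ≤ q → p * r ≤ q * r
  *-monoʳ-≤-≥0 r r≥0 = *-monoʳ-≤-nonNeg r {{nonNegative r≥0}}

  *-≥0 : ∀ {p q} → 0ℚ ≤ p → 0ℚ ≤ q → 0ℚ ≤ p * q
  *-≥0 {p} {q} p≥0 q≥0 = subst (_≤ p * q) (*-zeroʳ p) (*-monoˡ-≤-≥0 p p≥0 q≥0)

  pow-nonNeg : ∀ b m → 0ℚ ≤ b → 0ℚ ≤ pow b m
  pow-nonNeg b zero    b≥0 = toWitness {a? = 0ℚ ≤? 1ℚ} _
  pow-nonNeg b (suc m) b≥0 = *-≥0 b≥0 (pow-nonNeg b m b≥0)

  pow-≤1 : ∀ b m → 0ℚ ≤ b → b ≤ 1ℚ → pow b m ≤ 1ℚ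
  pow-≤1 b zero    b≥0 b≤1 = ≤-refl
  pow-≤1 b (suc m) b≥0 b≤1 =
    ≤-trans (*-monoˡ-≤-≥0 b b≥0 (pow-≤1 b m b≥0 b≤1)) (subst (_≤ 1ℚ) (sym (*-identityʳ b)) b≤1)

  -- (1 + x)^m (1 - m x) ≤ 1 for x ≥ 0; an upper companion of Bernoulli's
  -- inequality, giving (1 + x)^m ≤ 1/(1 - m x) when m x < 1.
  pow-mul-bound : ∀ x m → 0ℚ ≤ x → pow (1ℚ + x) m * (1ℚ - fromℕ m * x) ≤ 1ℚ
  pow-mul-bound x zero    _   = ≤-reflexive (solve 1 (λ x → con 1ℚ :* (con 1ℚ :- con 0ℚ :* x) := con 1ℚ) refl x)
    where open +-*-Solver
  pow-mul-bound x (suc m) x≥0 = begin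
    pow (1ℚ + x) (suc m) * (1ℚ - fromℕ (suc m) * x)
      ≡⟨ cong (λ z → pow (1ℚ + x) (suc m) * (1ℚ - z * x)) (fromℕ-suc m) ⟩
    (1ℚ + x) * P * (1ℚ - (1ℚ + M) * x)                 ≡⟨ regroup x P M ⟩
    P * ((1ℚ - M * x) - (1ℚ + M) * (x * x))            ≤⟨ *-monoˡ-≤-≥0 P (pow-nonNeg (1ℚ + x) m (1+x≥0)) drop ⟩
    P * (1ℚ - M * x)                                   ≤⟨ pow-mul-bound x m x≥0 ⟩
    1ℚ                                                 ∎
    where
    open ≤-Reasoning
    open +-*-Solver
    P = pow (1ℚ + x) m
    M = fromℕ m
    regroup : ∀ x P M → (1ℚ + x) * P * (1ℚ - (1ℚ + M) * x) ≡ P * ((1ℚ - M * x) - (1ℚ + M) * (x * x))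
    regroup = solve 3 (λ x P M → (con 1ℚ :+ x) :* P :* (con 1ℚ :- (con 1ℚ :+ M) :* x)
                               := P :* ((con 1ℚ :- M :* x) :- (con 1ℚ :+ M) :* (x :* x))) refl
    1+x≥0 : 0ℚ ≤ 1ℚ + x
    1+x≥0 = ≤-trans x≥0 (subst (_≤ 1ℚ + x) (+-identityˡ x) (+-monoˡ-≤ x (toWitness {a? = 0ℚ ≤? 1ℚ} _)))
    drop : (1ℚ - M * x) - (1ℚ + M) * (x * x) ≤ 1ℚ - M * x
    drop = subst ((1ℚ - M * x) - (1ℚ + M) * (x * x) ≤_) (+-identityʳ (1ℚ - M * x))
      (+-monoʳ-≤ (1ℚ - M * x) (neg-antimono-≤
        (*-≥0 (subst (0ℚ ≤_) (fromℕ-suc m) (fromℕ-nonNeg (suc m))) (*-≥0 x≥0 x≥0))))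

  base-nonNeg : ∀ N x → 0ℚ < fromℕ (suc N) + x → 0ℚ ≤ 1ℚ + x * step N
  base-nonNeg N x pos = subst (0ℚ ≤_)
    (trans (*-distribʳ-+ (step N) (fromℕ (suc N)) x) (cong (_+ x * step N) (fromℕ*step N)))
    (*-≥0 (<⇒≤ pos) (step-nonNeg N))

  expGt-nonPos : ∀ {x q} → x ≤ 0ℚ → ExpGt x q → q < 1ℚ
  expGt-nonPos {x} x≤0 (N , pos , q<pow) =
    <-≤-trans q<pow (pow-≤1 (1ℚ + x * step N) (suc N) (base-nonNeg N x pos) base≤1)
    where
    base≤1 : 1ℚ + x * step N ≤ 1ℚ
    base≤1 = subst (1ℚ + x * step N ≤_) (+-identityʳ 1ℚ) (+-monoʳ-≤ 1ℚ
      (subst (x * step N ≤_) (*-zeroˡ (step N)) (*-monoʳ-≤-≥0 (step N) (step-nonNeg N) x≤0)))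

  -- e^t < 2 for 0 ≤ t < 1/2: each approximant P satisfies P (1 - t) ≤ 1 < 2 (1 - t)
  expGt-half : ∀ {t q} → 0ℚ ≤ t → t + t < 1ℚ → ExpGt t q → q < fromℕ 2
  expGt-half {t} t≥0 2t<1 (N , _ , q<P) = <-trans q<P
    (*-cancelʳ-<-nonNeg (1ℚ - t) {{nonNegative (<⇒≤ (≤-<-trans t≥0 t<1-t))}} (≤-<-trans approximant-bound one<))
    where
    open +-*-Solver
    x = t * step N
    P = pow (1ℚ + x) (suc N)
    Mx≡t : fromℕ (suc N) * x ≡ t
    Mx≡t = trans (solve 3 (λ M t s → M :* (t :* s) := t :* (M :* s)) refl (fromℕ (suc N)) t (step N))
                 (trans (cong (t *_) (fromℕ*step N)) (*-identityʳ t))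
    approximant-bound : P * (1ℚ - t) ≤ 1ℚ
    approximant-bound = subst (λ z → P * (1ℚ - z) ≤ 1ℚ) Mx≡t
      (pow-mul-bound x (suc N) (*-≥0 t≥0 (step-nonNeg N)))
    0<1-2t : 0ℚ < 1ℚ - (t + t)
    0<1-2t = subst (_< 1ℚ - (t + t)) (+-inverseʳ (t + t)) (+-monoˡ-< (- (t + t)) 2t<1)
    t<1-t : t < 1ℚ - t
    t<1-t = subst₂ _<_ (solve 1 (λ t → con 0ℚ :+ t := t) refl t)
                      (solve 1 (λ t → (con 1ℚ :- (t :+ t)) :+ t := con 1ℚ :- t) refl t)
                      (+-monoˡ-< t 0<1-2t)
    one< : 1ℚ < fromℕ 2 * (1ℚ - t)
    one< = subst₂ _<_ (+-identityʳ 1ℚ)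
                      (solve 1 (λ t → con 1ℚ :+ (con 1ℚ :- (t :+ t)) := (con 1ℚ :+ con 1ℚ) :* (con 1ℚ :- t)) refl t)
                      (+-monoʳ-< 1ℚ 0<1-2t)

  exponent : ℕ → ℕ → ℚ
  exponent k L = ((+ L ℤ.- + (3217 ℕ.* k ℕ.+ 1985)) / (304 ℕ.* suc k)) - fromℕ 4

  -- for small L the numerator is negative, hence B ≤ 0
  exponent-nonPos : ∀ k L → L ℕ.≤ 6 → exponent k L ≤ 0ℚ
  exponent-nonPos k L L≤6 =
    ≤-trans (+-monoˡ-≤ (- fromℕ 4) fraction≤0) (toWitness {a? = (0ℚ - fromℕ 4) ≤? 0ℚ} _)
    where
    a = + L ℤ.- + (3217 ℕ.* k ℕ.+ 1985)
    a≤0 : a ℤ.≤ ℤ.0ℤ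
    a≤0 = ℤ.i≤j⇒i-j≤0 (ℤ.+≤+ (ℕ.≤-trans L≤6 (ℕ.≤-trans (ℕ.m≤m+n 6 1979) (ℕ.m≤n+m 1985 (3217 ℕ.* k)))))
    fraction≤0 : a / (304 ℕ.* suc k) ≤ 0ℚ
    fraction≤0 = toℚᵘ-cancel-≤ (U.≤-respˡ-≃ (U.≃-sym (toℚᵘ-/ a (k ℕ.+ 303 ℕ.* suc k))) (U.*≤*
      (subst₂ ℤ._≤_ (sym (ℤ.*-identityʳ a)) (sym (ℤ.*-zeroˡ (+ suc (k ℕ.+ 303 ℕ.* suc k)))) a≤0)))

  -- μ_k < L forces L ≥ 7: with K = k + 1 ≥ 2, MuLt provides t with K < e^t and
  -- K t < e^B ≤ 1; then t < 1/2, so e^t < 2 ≤ K (or t ≤ 0 and e^t ≤ 1).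
  muLt⇒7≤L : ∀ k L → 1 ℕ.≤ k → MuLt k L → 7 ℕ.≤ L
  muLt⇒7≤L k L k≥1 μ<L with L ℕ.≤? 6
  ... | no  L≰6 = ℕ.≰⇒> L≰6
  ... | yes L≤6 = ⊥-elim (small-L μ<L)
    where
    K = fromℕ (suc k)
    2≤K : fromℕ 2 ≤ K
    2≤K = fromℕ-mono-≤ (s≤s k≥1)
    small-L : MuLt k L → ⊥
    small-L (t , K<e^t , Kt<e^B) with ≤-total 0ℚ t
    ... | inj₂ t≤0 =
      <-irrefl refl (<-trans (<-≤-trans (toWitness {a? = 1ℚ <? fromℕ 2} _) 2≤K) (expGt-nonPos t≤0 K<e^t))
    ... | inj₁ t≥0 = <-irrefl refl (<-≤-trans (expGt-half t≥0 2t<1 K<e^t) 2≤K)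
      where
      2t<1 : t + t < 1ℚ
      2t<1 = ≤-<-trans (subst (_≤ K * t) (solve 1 (λ t → (con 1ℚ :+ con 1ℚ) :* t := t :+ t) refl t)
                          (*-monoʳ-≤-≥0 t t≥0 2≤K))
                       (expGt-nonPos (exponent-nonPos k L L≤6) Kt<e^B)
        where open +-*-Solver

open import Data.Nat using (ℕ; zero; suc; _+_; _∸_; _≤_; _<_; z≤n; s≤s; NonZero; >-nonZero; >-nonZero⁻¹; _%_; _/_; _≤ᵇ_)
open import Data.Nat.Properties
open import Data.Nat.DivMod
  using (m%n<n; m<n⇒m%n≡m; [m+n]%n≡m%n; [m+kn]%n≡m%n; m≡m%n+[m/n]*n; n%n≡0; m%n%n≡m%n; %-distribˡ-+; m≤n⇒[n∸m]%m≡n%m)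
import Data.Fin
open Data.Fin using (Fin; toℕ; fromℕ<)
open import Data.Fin.Properties using (toℕ-fromℕ<; toℕ-injective; toℕ<n; any?)
import Data.Bool
open Data.Bool using (true; false; T; if_then_else_)
open import Data.Unit using (tt)
open import Data.Product using (Σ; _×_; _,_; proj₁; proj₂)
open import Data.Sum using (_⊎_; inj₁; inj₂)
open import Data.Empty using (⊥-elim)
open import Relation.Nullary using (¬_; Dec; yes; no)
open import Relation.Binary.PropositionalEquality
open import Relation.Binary.Definitions using (tri<; tri≈; tri>)
open import Function.Bundles using (Equivalence)
open import Function using (_∘_)
open import Data.Nat.Tactic.RingSolver using (solve-∀)

reach-++ : ∀ {X : Set} {V : X → Set} {E : X → X → Set} {x y z} →
  Reach V E x y → Reach V E y z → Reach V E x z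
reach-++ here          r′ = r′
reach-++ (there e v r) r′ = there e v (reach-++ r r′)

first-witness : (P : ℕ → Set) → (∀ s → Dec (P s)) → ∀ w → P w →
  Σ ℕ λ f → f ≤ w × P f × (∀ s → s < f → ¬ P s)
first-witness P P? zero    pw = 0 , z≤n , pw , λ s ()
first-witness P P? (suc w) pw with P? 0
... | yes p0 = 0 , z≤n , p0 , λ s ()
... | no ¬p0 with first-witness (λ s → P (suc s)) (λ s → P? (suc s)) w pw
...   | f , f≤w , pf , minimal = suc f , s≤s f≤w , pf , below
  where
  below : ∀ s → s < suc f → ¬ P s
  below zero    _         = ¬p0
  below (suc s) (s≤s s<f) = minimal s s<f

last-witness-below : (P : ℕ → Set) → (∀ s → Dec (P s)) → P 0 → ∀ f → 0 < f →
  Σ ℕ λ a → a < f × P a × (∀ s → a < s → s < f → ¬ P s)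
last-witness-below P P? p0 (suc zero) _ = 0 , s≤s z≤n , p0 , λ { s a<s (s≤s s≤0) → ⊥-elim (<⇒≱ a<s s≤0) }
last-witness-below P P? p0 (suc (suc f)) _ with P? (suc f) | last-witness-below P P? p0 (suc f) (s≤s z≤n)
... | yes pf | _ = suc f , ≤-refl , pf , λ { s a<s (s≤s s≤) → ⊥-elim (<⇒≱ a<s s≤) }
... | no ¬pf | a , a<f , pa , maximal = a , m≤n⇒m≤1+n a<f , pa , above
  where
  above : ∀ s → a < s → s < suc (suc f) → ¬ P s
  above s a<s (s≤s s≤sf) with m≤n⇒m<n∨m≡n s≤sf
  ... | inj₁ s<sf  = maximal s a<s s<sf
  ... | inj₂ refl = ¬pf

Meeting : (P Q : ℕ → Set) → ℕ → Set
Meeting P Q x = (Σ ℕ λ s → P (x + s) × Q (x + s)) ⊎ (Σ ℕ λ s → P (x + s) × Q (suc (x + s)))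

record CleanArc (P Q : ℕ → Set) (x w : ℕ) : Set where
  field
    start   : ℕ
    len     : ℕ
    len≥2   : 2 ≤ len
    within  : start + len ≤ w
    P-start : P (x + start)
    Q-end   : Q (x + start + len)
    P-free  : ∀ s → 1 ≤ s → s ≤ len → ¬ P (x + start + s)
    Q-free  : ∀ s → s < len → ¬ Q (x + start + s)
    Q-first : ∀ s → s < start + len → ¬ Q (x + s)

-- Walking from a P-position x to a Q-position x + w, P and Q either meet or
-- there is a clean arc: take the first Q-position and the last P-position before it.
meet-or-clean-arc : (P Q : ℕ → Set) → (∀ s → Dec (P s)) → (∀ s → Dec (Q s)) →
  ∀ x → P x → ∀ w → Q (x + w) → Meeting P Q x ⊎ CleanArc P Q x w
meet-or-clean-arc P Q P? Q? x px w qw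
  with first-witness (λ s → Q (x + s)) (λ s → Q? (x + s)) w qw
... | f , f≤w , q-f , Q-first with P? (x + f)
...   | yes p-f = inj₁ (inj₁ (f , p-f , q-f))
...   | no ¬p-f = last-P (last-witness-below (λ s → P (x + s)) (λ s → P? (x + s)) px0 f f>0)
  where
  px0 : P (x + 0)
  px0 = subst P (sym (+-identityʳ x)) px
  positive : ∀ g → ¬ P (x + g) → 0 < g
  positive zero    ¬p = ⊥-elim (¬p px0)
  positive (suc _) _  = s≤s z≤n
  f>0 : 0 < f
  f>0 = positive f ¬p-f
  last-P : (Σ ℕ λ a → a < f × P (x + a) × (∀ s → a < s → s < f → ¬ P (x + s))) → Meeting P Q x ⊎ CleanArc P Q x w
  last-P (a , a<f , p-a , P-last) with f ∸ a | m+[n∸m]≡n (<⇒≤ a<f)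
  ... | zero         | a+0≡f = ⊥-elim (<-irrefl (trans (sym (+-identityʳ a)) a+0≡f) a<f)
  ... | suc zero     | a+1≡f = inj₁ (inj₂ (a , p-a ,
          subst Q (trans (cong (x +_) (trans (sym a+1≡f) (+-comm a 1))) (+-suc x a)) q-f))
  ... | suc (suc d′) | a+d≡f = inj₂ record
    { start = a ; len = suc (suc d′) ; len≥2 = s≤s (s≤s z≤n) ; within = subst (_≤ w) (sym a+d≡f) f≤w
    ; P-start = p-a ; Q-end = subst Q (trans (cong (x +_) (sym a+d≡f)) (sym (+-assoc x a _))) q-f
    ; P-free = P-free ; Q-free = Q-free ; Q-first = λ s s<a+d → Q-first s (subst (s <_) a+d≡f s<a+d) }
    where
    P-free : ∀ s → 1 ≤ s → s ≤ suc (suc d′) → ¬ P (x + a + s)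
    P-free s s≥1 s≤d p with m≤n⇒m<n∨m≡n s≤d
    ... | inj₁ s<d  = P-last (a + s) (m<m+n a s≥1) (subst (a + s <_) a+d≡f (+-monoʳ-< a s<d)) (subst P (+-assoc x a s) p)
    ... | inj₂ refl = ¬p-f (subst P (trans (+-assoc x a _) (cong (x +_) a+d≡f)) p)
    Q-free : ∀ s → s < suc (suc d′) → ¬ Q (x + a + s)
    Q-free s s<d q = Q-first (a + s) (subst (a + s <_) a+d≡f (+-monoʳ-< a s<d)) (subst Q (+-assoc x a s) q)

module CyclicPositions (L : ℕ) {{_ : NonZero L}} where

  pos : ℕ → Fin L
  pos s = fromℕ< (m%n<n s L)

  toℕ-pos : ∀ s → toℕ (pos s) ≡ s % L
  toℕ-pos s = toℕ-fromℕ< (m%n<n s L)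

  pos-≡ : ∀ {s s′} → s % L ≡ s′ % L → pos s ≡ pos s′
  pos-≡ {s} {s′} e = toℕ-injective (trans (toℕ-pos s) (trans e (sym (toℕ-pos s′))))

  pos-≡⁻ : ∀ {s s′} → pos s ≡ pos s′ → s % L ≡ s′ % L
  pos-≡⁻ {s} {s′} e = trans (sym (toℕ-pos s)) (trans (cong toℕ e) (toℕ-pos s′))

  pos-toℕ : ∀ (i : Fin L) → pos (toℕ i) ≡ i
  pos-toℕ i = toℕ-injective (trans (toℕ-pos (toℕ i)) (m<n⇒m%n≡m (toℕ<n i)))

  pos-+L : ∀ s → pos (s + L) ≡ pos s
  pos-+L s = pos-≡ ([m+n]%n≡m%n s L)

  pos-turn : ∀ x k → L ≡ suc k → pos (suc (x + k)) ≡ pos x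
  pos-turn x k L≡k+1 = trans (cong pos (trans (sym (+-suc x k)) (cong (x +_) (sym L≡k+1)))) (pos-+L x)

  suc-% : ∀ s → suc s % L ≡ suc (s % L) % L
  suc-% s = trans (cong (λ z → suc z % L) (m≡m%n+[m/n]*n s L)) ([m+kn]%n≡m%n (suc (s % L)) (s / L) L)

  pos-next : ∀ s → CycNext (pos s) (pos (suc s))
  pos-next s with m≤n⇒m<n∨m≡n (m%n<n s L)
  ... | inj₁ r+1<L = inj₁ (begin
    toℕ (pos (suc s))  ≡⟨ toℕ-pos (suc s) ⟩
    suc s % L          ≡⟨ suc-% s ⟩
    suc (s % L) % L    ≡⟨ m<n⇒m%n≡m r+1<L ⟩
    suc (s % L)        ≡⟨ cong suc (toℕ-pos s) ⟨
    suc (toℕ (pos s))  ∎)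
    where open ≡-Reasoning
  ... | inj₂ r+1≡L = inj₂ (trans (cong suc (toℕ-pos s)) r+1≡L ,
    trans (toℕ-pos (suc s)) (trans (suc-% s) (trans (cong (_% L) r+1≡L) (n%n≡0 L))))

  pos-next⁻ : ∀ s s′ → CycNext (pos s) (pos s′) → s′ % L ≡ suc s % L
  pos-next⁻ s s′ next = begin
    s′ % L                 ≡⟨ m%n%n≡m%n s′ L ⟨
    s′ % L % L             ≡⟨ cong (_% L) (toℕ-pos s′) ⟨
    toℕ (pos s′) % L       ≡⟨ successor next ⟩
    suc (toℕ (pos s)) % L  ≡⟨ cong (λ z → suc z % L) (toℕ-pos s) ⟩
    suc (s % L) % L        ≡⟨ suc-% s ⟨
    suc s % L              ∎
    where
    open ≡-Reasoning
    successor : CycNext (pos s) (pos s′) → toℕ (pos s′) % L ≡ suc (toℕ (pos s)) % L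
    successor (inj₁ e)        = cong (_% L) e
    successor (inj₂ (e₁ , e₂)) =
      trans (cong (_% L) e₂) (trans (m<n⇒m%n≡m (>-nonZero⁻¹ L)) (sym (trans (cong (_% L) e₁) (n%n≡0 L))))

  offset-zero : ∀ p δ → δ < L → (p + δ) % L ≡ p % L → δ ≡ 0
  offset-zero p δ δ<L e with p % L | m%n<n p L | trans (sym (%-distribˡ-+ p δ L)) e
  ... | r | r<L | r+δ%L≡r rewrite m<n⇒m%n≡m δ<L with r + δ <? L
  ...   | yes r+δ<L = +-cancelˡ-≡ r δ 0 (trans (trans (sym (m<n⇒m%n≡m r+δ<L)) r+δ%L≡r) (sym (+-identityʳ r)))
  ...   | no  r+δ≮L = ⊥-elim (<-irrefl δ≡L δ<L)
    where
    L≤r+δ : L ≤ r + δ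
    L≤r+δ = ≮⇒≥ r+δ≮L
    wrapped<L : r + δ ∸ L < L
    wrapped<L = +-cancelʳ-< _ _ L (subst (_< L + L) (sym (m∸n+n≡m L≤r+δ)) (+-mono-< r<L δ<L))
    wrapped≡r : r + δ ∸ L ≡ r
    wrapped≡r = trans (sym (m<n⇒m%n≡m wrapped<L)) (trans (m≤n⇒[n∸m]%m≡n%m L≤r+δ) r+δ%L≡r)
    δ≡L : δ ≡ L
    δ≡L = +-cancelˡ-≡ r δ L (trans (sym (m∸n+n≡m L≤r+δ)) (cong (_+ L) wrapped≡r))

  window-injective-≤ : ∀ p q → p ≤ q → q < p + L → p % L ≡ q % L → p ≡ q
  window-injective-≤ p q p≤q q<p+L e = begin
    p              ≡⟨ +-identityʳ p ⟨
    p + 0          ≡⟨ cong (p +_) (offset-zero p (q ∸ p) δ<L (trans (cong (_% L) (m+[n∸m]≡n p≤q)) (sym e))) ⟨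
    p + (q ∸ p)    ≡⟨ m+[n∸m]≡n p≤q ⟩
    q              ∎
    where
    open ≡-Reasoning
    δ<L : q ∸ p < L
    δ<L = +-cancelˡ-< p _ _ (subst (_< p + L) (sym (m+[n∸m]≡n p≤q)) q<p+L)

  window-injective : ∀ y p q → y ≤ p → y ≤ q → p < y + L → q < y + L → p % L ≡ q % L → p ≡ q
  window-injective y p q y≤p y≤q p<y+L q<y+L e with ≤-total p q
  ... | inj₁ p≤q = window-injective-≤ p q p≤q (<-≤-trans q<y+L (+-monoˡ-≤ L y≤p)) e
  ... | inj₂ q≤p = sym (window-injective-≤ q p q≤p (<-≤-trans p<y+L (+-monoˡ-≤ L y≤q)) (sym e))

adj-irreflexive : ∀ {n} (G : Graph n) {u v} → Adj G u v → u ≢ v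
adj-irreflexive G {u} uv refl with trans (sym uv) (irrfl G u)
... | ()

adj-symmetric : ∀ {n} (G : Graph n) {u v} → Adj G u v → Adj G v u
adj-symmetric G {u} {v} uv = trans (adj-sym G v u) uv

module HoleFromSequence {n} (G : Graph n) (m : ℕ) (w : ℕ → Fin n)
  (m≥3        : 3 ≤ m)
  (distinct   : ∀ t t′ → t < t′ → t′ ≤ m → w t ≢ w t′)
  (consecutive : ∀ t → t < m → Adj G (w t) (w (suc t)))
  (closing    : Adj G (w 0) (w m))
  (induced    : ∀ t t′ → t < t′ → t′ ≤ m → Adj G (w t) (w t′) → (t′ ≡ suc t) ⊎ ((t ≡ 0) × (t′ ≡ m)))
  where

  cycle : Fin (suc m) → Fin n
  cycle i = w (toℕ i)

  toℕ≤m : (i : Fin (suc m)) → toℕ i ≤ m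
  toℕ≤m i = ≤-pred (toℕ<n i)

  cycle-injective : ∀ i j → cycle i ≡ cycle j → i ≡ j
  cycle-injective i j e with <-cmp (toℕ i) (toℕ j)
  ... | tri< i<j _ _ = ⊥-elim (distinct _ _ i<j (toℕ≤m j) e)
  ... | tri≈ _ i≡j _ = toℕ-injective i≡j
  ... | tri> _ _ j<i = ⊥-elim (distinct _ _ j<i (toℕ≤m i) (sym e))

  adj⇒cycAdj-< : ∀ i j → toℕ i < toℕ j → Adj G (cycle i) (cycle j) → CycAdj i j
  adj⇒cycAdj-< i j i<j a with induced _ _ i<j (toℕ≤m j) a
  ... | inj₁ e          = inj₁ (inj₁ e)
  ... | inj₂ (e₁ , e₂) = inj₂ (inj₂ (cong suc e₂ , e₁))

  adj⇒cycAdj : ∀ i j → Adj G (cycle i) (cycle j) → CycAdj i j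
  adj⇒cycAdj i j a with <-cmp (toℕ i) (toℕ j)
  ... | tri< i<j _ _ = adj⇒cycAdj-< i j i<j a
  ... | tri≈ _ i≡j _ = ⊥-elim (adj-irreflexive G a (cong cycle (toℕ-injective i≡j)))
  ... | tri> _ _ j<i with adj⇒cycAdj-< j i j<i (adj-symmetric G a)
  ...   | inj₁ next = inj₂ next
  ...   | inj₂ prev = inj₁ prev

  cycNext⇒adj : ∀ i j → CycNext i j → Adj G (cycle i) (cycle j)
  cycNext⇒adj i j (inj₁ e) =
    subst (λ z → Adj G (cycle i) (w z)) (sym e) (consecutive (toℕ i) (subst (_≤ m) e (toℕ≤m j)))
  cycNext⇒adj i j (inj₂ (e₁ , e₂)) =
    subst₂ (λ a b → Adj G (w a) (w b)) (sym (suc-injective e₁)) (sym e₂) (adj-symmetric G closing)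

  cycAdj⇒adj : ∀ i j → CycAdj i j → Adj G (cycle i) (cycle j)
  cycAdj⇒adj i j (inj₁ next) = cycNext⇒adj i j next
  cycAdj⇒adj i j (inj₂ prev) = adj-symmetric G (cycNext⇒adj j i prev)

  is-hole : IsHole G (suc m) cycle
  is-hole = s≤s m≥3 , cycle-injective , λ i j → record
    { to = adj⇒cycAdj i j ; from = cycAdj⇒adj i j ; to-cong = λ { refl → refl } ; from-cong = λ { refl → refl } }

module ShortestHole {n} (G : Graph n) (L : ℕ) {{_ : NonZero L}} (c : Fin L → Fin n)
  (hole : IsHole G L c) (shortest : ∀ L′ (c′ : Fin L′ → Fin n) → IsHole G L′ c′ → L ≤ L′) where

  open CyclicPositions L public

  at : ℕ → Fin n
  at s = c (pos s)

  at-≡ : ∀ s s′ → at s ≡ at s′ → s % L ≡ s′ % L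
  at-≡ s s′ e = pos-≡⁻ (proj₁ (proj₂ hole) _ _ e)

  at-next : ∀ s → Adj G (at s) (at (suc s))
  at-next s = Equivalence.from (proj₂ (proj₂ hole) _ _) (inj₁ (pos-next s))

  at-adj : ∀ s s′ → Adj G (at s) (at s′) → (s′ % L ≡ suc s % L) ⊎ (s % L ≡ suc s′ % L)
  at-adj s s′ a with Equivalence.to (proj₂ (proj₂ hole) _ _) a
  ... | inj₁ next = inj₁ (pos-next⁻ s s′ next)
  ... | inj₂ prev = inj₂ (pos-next⁻ s′ s prev)

  module Detour (y d r : ℕ) (q : ℕ → Fin n)
    (d+2≤L : d + 2 ≤ L) (long : 3 ≤ d + suc r)
    (q∉C   : ∀ j → j ≤ r → ¬ InC c (q j))
    (q-distinct : ∀ j j′ → j < j′ → j′ ≤ r → q j ≢ q j′)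
    (q-path : ∀ j → j < r → Adj G (q j) (q (suc j)))
    (q-induced : ∀ j j′ → j < j′ → j′ ≤ r → Adj G (q j) (q j′) → j′ ≡ suc j)
    (enter : Adj G (at (y + d)) (q 0))
    (leave : Adj G (at y) (q r))
    (attachments : ∀ t j → t ≤ d → j ≤ r → Adj G (at (y + t)) (q j) →
                   ((t ≡ d) × (j ≡ 0)) ⊎ ((t ≡ 0) × (j ≡ r)))
    where

    m : ℕ
    m = d + suc r

    w : ℕ → Fin n
    w t = if t ≤ᵇ d then at (y + t) else q (t ∸ suc d)

    w-arc : ∀ t → t ≤ d → w t ≡ at (y + t)
    w-arc t t≤d with t ≤ᵇ d | ≤⇒≤ᵇ t≤d
    ... | true | _ = refl

    w-path : ∀ j → w (suc d + j) ≡ q j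
    w-path j with (suc d + j) ≤ᵇ d in eq
    ... | false = cong q (m+n∸m≡n (suc d) j)
    ... | true  = ⊥-elim (<⇒≱ (m≤m+n (suc d) j) (≤ᵇ⇒≤ (suc d + j) d (subst T (sym eq) tt)))

    path-index : ∀ j → suc d + j ≤ m → j ≤ r
    path-index j le = +-cancelˡ-≤ (suc d) j r (subst (suc d + j ≤_) (+-suc d r) le)

    beyond-arc : ∀ t → ¬ t ≤ d → Σ ℕ λ j → t ≡ suc d + j
    beyond-arc t t≰d = t ∸ suc d , sym (m+[n∸m]≡n (≰⇒> t≰d))

    arc-injective : ∀ t t′ → t ≤ suc d → t′ ≤ suc d → (y + t) % L ≡ (y + t′) % L → t ≡ t′
    arc-injective t t′ t≤ t′≤ e = +-cancelˡ-≡ y t t′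
      (window-injective y (y + t) (y + t′) (m≤m+n y t) (m≤m+n y t′) (in-window t≤) (in-window t′≤) e)
      where
      in-window : ∀ {t} → t ≤ suc d → y + t < y + L
      in-window t≤ = +-monoʳ-< y (≤-<-trans t≤ (subst (_≤ L) (+-comm d 2) d+2≤L))

    distinct : ∀ t t′ → t < t′ → t′ ≤ m → w t ≢ w t′
    distinct t t′ t<t′ t′≤m e with t′ ≤? d
    ... | yes t′≤d = <-irrefl (arc-injective t t′ (≤-trans (<⇒≤ t<t′) (m≤n⇒m≤1+n t′≤d)) (m≤n⇒m≤1+n t′≤d)
                      (at-≡ _ _ (trans (sym (w-arc t (≤-trans (<⇒≤ t<t′) t′≤d))) (trans e (w-arc t′ t′≤d))))) t<t′
    ... | no t′≰d with beyond-arc t′ t′≰d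
    ...   | j′ , refl with t ≤? d
    ...     | yes t≤d = q∉C j′ (path-index j′ t′≤m) (pos (y + t) , trans (sym (w-arc t t≤d)) (trans e (w-path j′)))
    ...     | no t≰d with beyond-arc t t≰d
    ...       | j , refl = q-distinct j j′ (+-cancelˡ-< (suc d) j j′ t<t′) (path-index j′ t′≤m)
                             (trans (sym (w-path j)) (trans e (w-path j′)))

    consecutive : ∀ t → t < m → Adj G (w t) (w (suc t))
    consecutive t t<m with suc t ≤? d
    ... | yes t+1≤d = subst₂ (Adj G) (sym (w-arc t (<⇒≤ t+1≤d)))
                        (trans (cong at (sym (+-suc y t))) (sym (w-arc (suc t) t+1≤d))) (at-next (y + t))
    ... | no t+1≰d with t ≤? d
    ...   | yes t≤d with ≤-antisym t≤d (≤-pred (≰⇒> t+1≰d))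
    ...     | refl = subst₂ (Adj G) (sym (w-arc t t≤d)) (trans (sym (w-path 0)) (cong w (+-identityʳ (suc t)))) enter
    consecutive t t<m | no _ | no t≰d with beyond-arc t t≰d
    ...     | j , refl = subst₂ (Adj G) (sym (w-path j)) (trans (sym (w-path (suc j))) (cong w (+-suc (suc d) j)))
                           (q-path j (+-cancelˡ-< (suc d) j r (subst (suc d + j <_) (+-suc d r) t<m)))

    closing : Adj G (w 0) (w m)
    closing = subst₂ (Adj G) (trans (cong at (sym (+-identityʳ y))) (sym (w-arc 0 z≤n)))
                (trans (sym (w-path r)) (cong w (sym (+-suc d r)))) leave

    induced : ∀ t t′ → t < t′ → t′ ≤ m → Adj G (w t) (w t′) → (t′ ≡ suc t) ⊎ ((t ≡ 0) × (t′ ≡ m))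
    induced t t′ t<t′ t′≤m a with t′ ≤? d
    ... | yes t′≤d
      with at-adj (y + t) (y + t′) (subst₂ (Adj G) (w-arc t (≤-trans (<⇒≤ t<t′) t′≤d)) (w-arc t′ t′≤d) a)
    ...   | inj₁ e = inj₁ (arc-injective t′ (suc t) (m≤n⇒m≤1+n t′≤d) (s≤s (≤-trans (<⇒≤ t<t′) t′≤d))
                             (trans e (cong (_% L) (sym (+-suc y t)))))
    ...   | inj₂ e = ⊥-elim (<-asym t<t′ (≤-reflexive (sym (arc-injective t (suc t′)
                       (≤-trans (<⇒≤ t<t′) (m≤n⇒m≤1+n t′≤d)) (s≤s t′≤d) (trans e (cong (_% L) (sym (+-suc y t′))))))))
    induced t t′ t<t′ t′≤m a | no t′≰d with beyond-arc t′ t′≰d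
    ...   | j′ , refl with t ≤? d
    ...     | yes t≤d with attachments t j′ t≤d (path-index j′ t′≤m) (subst₂ (Adj G) (w-arc t t≤d) (w-path j′) a)
    ...       | inj₁ (refl , refl) = inj₁ (+-identityʳ (suc t))
    ...       | inj₂ (refl , refl) = inj₂ (refl , sym (+-suc d r))
    induced t t′ t<t′ t′≤m a | no _ | j′ , refl | no t≰d with beyond-arc t t≰d
    ...       | j , refl with q-induced j j′ (+-cancelˡ-< (suc d) j j′ t<t′) (path-index j′ t′≤m)
                                (subst₂ (Adj G) (w-path j) (w-path j′) a)
    ...         | refl = inj₁ (+-suc (suc d) j)

    length-bound : L ≤ suc (d + suc r)
    length-bound = shortest (suc m) _ (HoleFromSequence.is-hole G m w long distinct consecutive closing induced)

  Sees : Fin n → ℕ → Set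
  Sees u s = Adj G (at s) u

  sees? : ∀ u s → Dec (Sees u s)
  sees? u s = adj G (at s) u Data.Bool.≟ true

  sees-% : ∀ u {s s′} → s % L ≡ s′ % L → Sees u s → Sees u s′
  sees-% u e = subst (λ i → Adj G (c i) u) (pos-≡ e)

  sees-+L : ∀ u s → Sees u s → Sees u (s + L)
  sees-+L u s = sees-% u (sym ([m+n]%n≡m%n s L))

  sees-+L⁻ : ∀ u s → Sees u (s + L) → Sees u s
  sees-+L⁻ u s = sees-% u ([m+n]%n≡m%n s L)

  -- A vertex u outside the hole that sees y and y + d but no position in between
  -- closes a hole of length d + 2 with the arc between them.
  gap-vertex : ∀ u → ¬ InC c u → ∀ y d → 2 ≤ d → Sees u y → Sees u (y + d) →
    (∀ s → 1 ≤ s → s < d → ¬ Sees u (y + s)) → L ≤ d + 2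
  gap-vertex u u∉C y d d≥2 sees-y sees-y+d gap with d + 2 ≤? L
  ... | no  d+2≰L = <⇒≤ (≰⇒> d+2≰L)
  ... | yes d+2≤L = subst (L ≤_) (sym (+-suc d 1))
    (Detour.length-bound y d 0 (λ _ → u) d+2≤L (subst (3 ≤_) (+-comm 1 d) (s≤s d≥2))
      (λ _ _ → u∉C) (λ { _ _ j<j′ z≤n → ⊥-elim (n≮0 j<j′) }) (λ _ ()) (λ { _ _ j<j′ z≤n _ → ⊥-elim (n≮0 j<j′) })
      sees-y+d sees-y attachments)
    where
    attachments : ∀ t j → t ≤ d → j ≤ 0 → Sees u (y + t) → ((t ≡ d) × (j ≡ 0)) ⊎ ((t ≡ 0) × (j ≡ 0))
    attachments zero    .zero _   z≤n _ = inj₂ (refl , refl)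
    attachments (suc t) .zero t<d z≤n a with m≤n⇒m<n∨m≡n t<d
    ... | inj₁ t+1<d = ⊥-elim (gap (suc t) (s≤s z≤n) t+1<d a)
    ... | inj₂ t+1≡d = inj₁ (t+1≡d , refl)

  -- An edge u v outside the hole, where u sees y and v sees y + d while u sees
  -- nothing in (y, y + d] and v nothing in [y, y + d), closes a hole of length d + 3.
  gap-edge : ∀ u v → ¬ InC c u → ¬ InC c v → Adj G u v → ∀ y d → 2 ≤ d →
    Sees u y → Sees v (y + d) →
    (∀ s → 1 ≤ s → s ≤ d → ¬ Sees u (y + s)) → (∀ s → s < d → ¬ Sees v (y + s)) → L ≤ d + 3
  gap-edge u v u∉C v∉C uv y d d≥2 sees-u sees-v gap-u gap-v with d + 2 ≤? L
  ... | no  d+2≰L = ≤-trans (<⇒≤ (≰⇒> d+2≰L)) (+-monoʳ-≤ d (n≤1+n 2))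
  ... | yes d+2≤L = subst (L ≤_) (sym (+-suc d 2))
    (Detour.length-bound y d 1 q d+2≤L (+-monoˡ-≤ 2 (≤-trans (s≤s z≤n) d≥2))
      q∉C q-distinct q-path q-induced sees-v sees-u attachments)
    where
    q : ℕ → Fin n
    q zero    = v
    q (suc _) = u
    q∉C : ∀ j → j ≤ 1 → ¬ InC c (q j)
    q∉C zero    _ = v∉C
    q∉C (suc j) _ = u∉C
    q-distinct : ∀ j j′ → j < j′ → j′ ≤ 1 → q j ≢ q j′
    q-distinct zero    (suc zero)    _         _         e = adj-irreflexive G uv (sym e)
    q-distinct (suc j) (suc zero)    (s≤s ())  _         e
    q-distinct _       (suc (suc _)) _         (s≤s ())  e
    q-path : ∀ j → j < 1 → Adj G (q j) (q (suc j))
    q-path zero    _        = adj-symmetric G uv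
    q-path (suc j) (s≤s ())
    q-induced : ∀ j j′ → j < j′ → j′ ≤ 1 → Adj G (q j) (q j′) → j′ ≡ suc j
    q-induced zero    (suc zero)    _        _        _ = refl
    q-induced (suc j) (suc zero)    (s≤s ()) _        _
    q-induced _       (suc (suc _)) _        (s≤s ()) _
    attachments : ∀ t j → t ≤ d → j ≤ 1 → Adj G (at (y + t)) (q j) → ((t ≡ d) × (j ≡ 0)) ⊎ ((t ≡ 0) × (j ≡ 1))
    attachments t zero t≤d _ a with m≤n⇒m<n∨m≡n t≤d
    ... | inj₁ t<d = ⊥-elim (gap-v t t<d a)
    ... | inj₂ t≡d = inj₁ (t≡d , refl)
    attachments zero    (suc zero)    _   _        _ = inj₂ (refl , refl)
    attachments (suc t) (suc zero)    t<d _        a = ⊥-elim (gap-u (suc t) (s≤s z≤n) t<d a)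
    attachments t       (suc (suc j)) _   (s≤s ()) _

module Neighbourhood {n} (G : Graph n) (L : ℕ) {{_ : NonZero L}} (c : Fin L → Fin n)
  (hole : IsHole G L c) (shortest : ∀ L′ (c′ : Fin L′ → Fin n) → IsHole G L′ c′ → L ≤ L′)
  (L≥7 : 7 ≤ L) (H : SubgraphOfGnbd G c) where

  open ShortestHole G L c hole shortest

  InH : Fin n → Set
  InH v = VH H v ≡ true

  ReachSp : Fin L → Fin L → Set
  ReachSp = Reach (InSp G c H) CycAdj

  forward : ∀ s → CycAdj (pos s) (pos (suc s))
  forward s = inj₁ (pos-next s)

  backward : ∀ s → CycAdj (pos (suc s)) (pos s)
  backward s = inj₂ (pos-next s)

  ∉D : ∀ {u} → InH u → ¬ InD G c u
  ∉D {u} u∈H = proj₂ (V⊆ H u u∈H)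

  module OutsideVertex (u : Fin n) (u∈H : InH u) (u∉C : ¬ InC c u) where

    sp : ∀ {s} → Sees u s → InSp G c H (pos s)
    sp sees = u , u∈H , inj₁ (inj₂ (sees , u∉C , ∉D u∈H))

    far-next : ∀ x e → Sees u x → ¬ Sees u (suc x) → Sees u (x + suc e) → L ≤ 3 + e
    far-next x e sees-x ¬sees-next sees-far
      with first-witness (λ s → Sees u (x + suc s)) (λ s → sees? u (x + suc s)) e sees-far
    ... | zero  , _   , sees-g , _ =
      ⊥-elim (¬sees-next (subst (Sees u) (trans (+-suc x 0) (cong suc (+-identityʳ x))) sees-g))
    ... | suc g , g<e , sees-g , before = begin
      L                    ≤⟨ gap-vertex u u∉C x (suc (suc g)) (s≤s (s≤s z≤n)) sees-x sees-g gap ⟩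
      suc (suc g) + 2      ≡⟨ +-comm (suc (suc g)) 2 ⟩
      4 + g                ≤⟨ s≤s (s≤s (s≤s g<e)) ⟩
      3 + e                ∎
      where
      open ≤-Reasoning
      gap : ∀ s → 1 ≤ s → s < suc (suc g) → ¬ Sees u (x + s)
      gap (suc s) _ (s≤s s<g+1) = before s s<g+1

    -- neighbours x and x + e + 1 nearly a full turn apart are joined backwards
    -- through at most one further neighbour (a second gap would give a hole of length 4)
    wrap-back : ∀ x e → suc e < L → L ≤ 3 + e → Sees u x → Sees u (x + suc e) → ReachSp (pos x) (pos (x + suc e))
    wrap-back x e e+1<L L≤e+3 sees-x sees-far with m≤n⇒m<n∨m≡n L≤e+3
    ... | inj₁ (s≤s L≤e+2) =
      there (subst (λ i → CycAdj i (pos (x + suc e))) (pos-turn x (suc e) (≤-antisym L≤e+2 e+1<L))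
                   (backward (x + suc e)))
            (sp sees-far) here
    ... | inj₂ L≡e+3 with sees? u (x + suc (suc e))
    ...   | yes sees-prev =
      there (subst (λ i → CycAdj i (pos (x + suc (suc e)))) (pos-turn x (suc (suc e)) L≡e+3) (backward (x + suc (suc e))))
            (sp sees-prev)
            (there (subst (λ s → CycAdj (pos s) (pos (x + suc e))) (sym (+-suc x (suc e))) (backward (x + suc e)))
                   (sp sees-far) here)
    ...   | no ¬sees-prev =
      ⊥-elim (<⇒≱ L≥7 (≤-trans (gap-vertex u u∉C (x + suc e) 2 ≤-refl sees-far sees-x′ gap) (m≤m+n 4 2)))
      where
      sees-x′ : Sees u (x + suc e + 2)
      sees-x′ = subst (Sees u) (trans (cong (x +_) (trans L≡e+3 (cong suc (+-comm 2 e)))) (sym (+-assoc x (suc e) 2)))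
                      (sees-+L u x sees-x)
      gap : ∀ s → 1 ≤ s → s < 2 → ¬ Sees u (x + suc e + s)
      gap (suc zero) _ _ = ¬sees-prev ∘ subst (Sees u) (trans (+-assoc x (suc e) 1) (cong (x +_) (+-comm (suc e) 1)))
      gap (suc (suc s)) _ (s≤s (s≤s ()))

    sees-reach : ∀ e → e < L → ∀ x → Sees u x → Sees u (x + e) → ReachSp (pos x) (pos (x + e))
    sees-reach zero    _     x _      _        = subst (λ s → ReachSp (pos x) (pos s)) (sym (+-identityʳ x)) here
    sees-reach (suc e) e+1<L x sees-x sees-far with sees? u (suc x)
    ... | yes sees-next = there (forward x) (sp sees-next)
          (subst (λ s → ReachSp (pos (suc x)) (pos s)) (sym (+-suc x e))
            (sees-reach e (<-trans (n<1+n e) e+1<L) (suc x) sees-next (subst (Sees u) (+-suc x e) sees-far)))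
    ... | no ¬sees-next = wrap-back x e e+1<L (far-next x e sees-x ¬sees-next sees-far) sees-x sees-far

  ∈C? : ∀ u → Dec (InC c u)
  ∈C? u = any? (λ i → c i Data.Fin.≟ u)

  sees-Z : ∀ u → ¬ InC c u → ∀ i → InZ G c i u → Sees u (toℕ i)
  sees-Z u u∉C i (inj₁ u≡ci)      = ⊥-elim (u∉C (i , sym u≡ci))
  sees-Z u u∉C i (inj₂ (ci-u , _)) = subst (λ j → Adj G (c j) u) (sym (pos-toℕ i)) ci-u

  -- The positions i with u ∈ Z_i are connected in C[sp(H)]: for u on the hole there
  -- is only one, otherwise they are exactly the neighbours of u, read from i onwards.
  Z-reach : ∀ u → InH u → ∀ i j → InZ G c i u → InZ G c j u → ReachSp i j
  Z-reach u u∈H i j u∈Zi u∈Zj with ∈C? u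
  ... | yes (k , ck≡u) =
    subst (ReachSp i) (proj₁ (proj₂ hole) i j (trans (sym (on-hole i u∈Zi)) (on-hole j u∈Zj))) here
    where
    on-hole : ∀ i → InZ G c i u → u ≡ c i
    on-hole i (inj₁ u≡ci)      = u≡ci
    on-hole i (inj₂ (_ , u∉C , _)) = ⊥-elim (u∉C (k , ck≡u))
  ... | no u∉C with toℕ i ≤? toℕ j
  ...   | yes i≤j = subst₂ ReachSp (pos-toℕ i) (trans (cong pos (m+[n∸m]≡n i≤j)) (pos-toℕ j))
                     (sees-reach (toℕ j ∸ toℕ i) (≤-<-trans (m∸n≤m (toℕ j) (toℕ i)) (toℕ<n j)) (toℕ i) (sees-Z u u∉C i u∈Zi)
                       (subst (Sees u) (sym (m+[n∸m]≡n i≤j)) (sees-Z u u∉C j u∈Zj)))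
    where open OutsideVertex u u∈H u∉C
  ...   | no i≰j = subst₂ ReachSp (pos-toℕ i)
                     (trans (cong pos (m+[n∸m]≡n i≤j+L)) (trans (pos-+L (toℕ j)) (pos-toℕ j)))
                     (sees-reach (toℕ j + L ∸ toℕ i) offset<L (toℕ i) (sees-Z u u∉C i u∈Zi)
                       (subst (Sees u) (sym (m+[n∸m]≡n i≤j+L)) (sees-+L u (toℕ j) (sees-Z u u∉C j u∈Zj))))
    where
    open OutsideVertex u u∈H u∉C
    i≤j+L : toℕ i ≤ toℕ j + L
    i≤j+L = ≤-trans (<⇒≤ (toℕ<n i)) (m≤n+m L (toℕ j))
    offset<L : toℕ j + L ∸ toℕ i < L
    offset<L = +-cancelʳ-< (toℕ i) _ _ (subst (_< L + toℕ i) (sym (m∸n+n≡m i≤j+L))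
                 (subst (toℕ j + L <_) (+-comm (toℕ i) L) (+-monoˡ-< L (≰⇒> i≰j))))

  Touch : Fin n → Fin n → Set
  Touch u v = Σ (Fin L) λ i → Σ (Fin L) λ j → InZ G c i u × InZ G c j v × ((i ≡ j) ⊎ CycAdj i j)

  touch-sym : ∀ {u v} → Touch u v → Touch v u
  touch-sym (i , j , u∈Zi , v∈Zj , inj₁ i≡j)         = j , i , v∈Zj , u∈Zi , inj₁ (sym i≡j)
  touch-sym (i , j , u∈Zi , v∈Zj , inj₂ (inj₁ next)) = j , i , v∈Zj , u∈Zi , inj₂ (inj₂ next)
  touch-sym (i , j , u∈Zi , v∈Zj , inj₂ (inj₂ prev)) = j , i , v∈Zj , u∈Zi , inj₂ (inj₁ prev)

  Z-of-sees : ∀ {u s} → InH u → ¬ InC c u → Sees u s → InZ G c (pos s) u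
  Z-of-sees u∈H u∉C sees = inj₂ (sees , u∉C , ∉D u∈H)

  meeting⇒touch : ∀ {u v} → InH u → InH v → ¬ InC c u → ¬ InC c v → ∀ x → Meeting (Sees u) (Sees v) x → Touch u v
  meeting⇒touch u∈H v∈H u∉C v∉C x (inj₁ (s , su , sv)) =
    pos (x + s) , pos (x + s) , Z-of-sees u∈H u∉C su , Z-of-sees v∈H v∉C sv , inj₁ refl
  meeting⇒touch u∈H v∈H u∉C v∉C x (inj₂ (s , su , sv)) =
    pos (x + s) , pos (suc (x + s)) , Z-of-sees u∈H u∉C su , Z-of-sees v∈H v∉C sv , inj₂ (forward (x + s))

  some-sees : ∀ u → InH u → ¬ InC c u → Σ ℕ λ x → x < L × Sees u x
  some-sees u u∈H u∉C with proj₁ (V⊆ H u u∈H)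
  ... | inj₁ u∈C      = ⊥-elim (u∉C u∈C)
  ... | inj₂ (i , u-ci) = toℕ i , toℕ<n i , subst (λ j → Adj G (c j) u) (sym (pos-toℕ i)) (adj-symmetric G u-ci)

  sees-ahead : ∀ u x x′ → x ≤ L → Sees u x′ → Sees u (x + (x′ + (L ∸ x)))
  sees-ahead u x x′ x≤L sees = subst (Sees u) (begin
    x′ + L              ≡⟨ cong (x′ +_) (m+[n∸m]≡n x≤L) ⟨
    x′ + (x + (L ∸ x))  ≡⟨ +-assoc x′ x (L ∸ x) ⟨
    x′ + x + (L ∸ x)    ≡⟨ cong (_+ (L ∸ x)) (+-comm x′ x) ⟩
    x + x′ + (L ∸ x)    ≡⟨ +-assoc x x′ (L ∸ x) ⟩
    x + (x′ + (L ∸ x))  ∎) (sees-+L u x′ sees)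
    where open ≡-Reasoning

  sees-around : ∀ u s d → d ≤ L → Sees u s → Sees u (s + d + (L ∸ d))
  sees-around u s d d≤L sees =
    subst (Sees u) (trans (cong (s +_) (sym (m+[n∸m]≡n d≤L))) (sym (+-assoc s d (L ∸ d)))) (sees-+L u s sees)

  -- a clean arc ending at a neighbour of v spans less than a full turn,
  -- since the neighbours of v recur every L steps
  clean-arc-short : ∀ {P} v x w → (arc : CleanArc P (Sees v) x w) →
    CleanArc.start arc + CleanArc.len arc < L
  clean-arc-short v x w arc with CleanArc.start arc + CleanArc.len arc <? L
  ... | yes a+d<L = a+d<L
  ... | no  a+d≮L = ⊥-elim (Q-first (a + d ∸ L) (∸-monoʳ-< {o = 0} (>-nonZero⁻¹ L) (≮⇒≥ a+d≮L))
                      (sees-+L⁻ v (x + (a + d ∸ L)) (subst (Sees v) (begin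
                        x + start + len     ≡⟨ +-assoc x a d ⟩
                        x + (a + d)         ≡⟨ cong (x +_) (m∸n+n≡m (≮⇒≥ a+d≮L)) ⟨
                        x + (a + d ∸ L + L) ≡⟨ +-assoc x _ L ⟨
                        x + (a + d ∸ L) + L ∎) Q-end)))
    where
    open CleanArc arc
    open ≡-Reasoning
    a = start
    d = len

  -- Clean arcs from u to v and back from v to u, placed one after the other within
  -- one turn, each close a hole of length (its length) + 3; as the two lengths sum to
  -- at most L, this forces L ≤ 6.
  opposite-arcs : ∀ u v → ¬ InC c u → ¬ InC c v → Adj G u v → ∀ x w → (arc : CleanArc (Sees u) (Sees v) x w) →
    CleanArc (Sees v) (Sees u) (x + CleanArc.start arc + CleanArc.len arc) (L ∸ CleanArc.len arc) → L ≤ 6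
  opposite-arcs u v u∉C v∉C uv x w arc arc′ = +-cancelˡ-≤ L L 6 (begin
    L + L              ≤⟨ +-mono-≤ there-bound back-bound ⟩
    (d + 3) + (d′ + 3) ≡⟨ regroup d d′ ⟩
    (d + d′) + 6       ≤⟨ +-monoˡ-≤ 6 lengths ⟩
    L + 6              ∎)
    where
    open ≤-Reasoning
    module A  = CleanArc arc
    module A′ = CleanArc arc′
    d  = A.len
    d′ = A′.len
    regroup : ∀ d d′ → (d + 3) + (d′ + 3) ≡ (d + d′) + 6
    regroup = solve-∀
    there-bound : L ≤ d + 3
    there-bound = gap-edge u v u∉C v∉C uv (x + A.start) d A.len≥2 A.P-start A.Q-end A.P-free A.Q-free
    back-bound : L ≤ d′ + 3
    back-bound = gap-edge v u v∉C u∉C (adj-symmetric G uv) (x + A.start + d + A′.start) d′ A′.len≥2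
                   A′.P-start A′.Q-end A′.P-free A′.Q-free
    d≤L : d ≤ L
    d≤L = ≤-trans (m≤n+m d A.start) (<⇒≤ (clean-arc-short v x w arc))
    lengths : d + d′ ≤ L
    lengths = ≤-trans (+-monoʳ-≤ d (≤-trans (m≤n+m d′ A′.start) A′.within)) (≤-reflexive (m+[n∸m]≡n d≤L))

  -- Walk forward from a neighbour of u:
  -- either u and v meet, or a clean arc leads to v; walking on from there either v and
  -- u meet, or a clean arc leads back to u, which is impossible for L ≥ 7.
  adjacent-outside-touch : ∀ u v → InH u → InH v → ¬ InC c u → ¬ InC c v → Adj G u v → Touch u v
  adjacent-outside-touch u v u∈H v∈H u∉C v∉C uv
    with some-sees u u∈H u∉C | some-sees v v∈H v∉C
  ... | x , x<L , sees-x | x′ , _ , sees-x′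
    with meet-or-clean-arc (Sees u) (Sees v) (sees? u) (sees? v) x sees-x _ (sees-ahead v x x′ (<⇒≤ x<L) sees-x′)
  ...   | inj₁ meet = meeting⇒touch u∈H v∈H u∉C v∉C x meet
  ...   | inj₂ arc
    with meet-or-clean-arc (Sees v) (Sees u) (sees? v) (sees? u) (x + CleanArc.start arc + CleanArc.len arc)
           (CleanArc.Q-end arc) _
           (sees-around u _ _ (≤-trans (m≤n+m _ (CleanArc.start arc)) (<⇒≤ (clean-arc-short v x _ arc)))
                        (CleanArc.P-start arc))
  ...     | inj₁ meet′ = touch-sym (meeting⇒touch v∈H u∈H v∉C u∉C _ meet′)
  ...     | inj₂ arc′  = ⊥-elim (<⇒≱ L≥7 (opposite-arcs u v u∉C v∉C uv x _ arc arc′))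

  edge-touch : ∀ u v → InH u → InH v → Adj G u v → Touch u v
  edge-touch u v u∈H v∈H uv with ∈C? u | ∈C? v
  ... | yes (i , ci≡u) | yes (j , cj≡v) =
    i , j , inj₁ (sym ci≡u) , inj₁ (sym cj≡v) ,
    inj₂ (Equivalence.to (proj₂ (proj₂ hole) i j) (subst₂ (Adj G) (sym ci≡u) (sym cj≡v) uv))
  ... | yes (i , ci≡u) | no v∉C =
    i , i , inj₁ (sym ci≡u) , inj₂ (subst (λ z → Adj G z v) (sym ci≡u) uv , v∉C , ∉D v∈H) , inj₁ refl
  ... | no u∉C | yes (j , cj≡v) =
    j , j , inj₂ (subst (λ z → Adj G z u) (sym cj≡v) (adj-symmetric G uv) , u∉C , ∉D u∈H) , inj₁ (sym cj≡v) , inj₁ refl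
  ... | no u∉C | no v∉C = adjacent-outside-touch u v u∈H v∈H u∉C v∉C uv

  ReachH : Fin n → Fin n → Set
  ReachH = Reach InH (λ u v → EH H u v ≡ true)

  -- A walk in H from u to w lifts to a walk in C[sp(H)] from any i with u ∈ Z_i to any
  -- j with w ∈ Z_j: inside one Z-set by Z-reach, across an edge of H by edge-touch.
  walk-lift : ∀ {u w} → ReachH u w → InH u → ∀ i j → InZ G c i u → InZ G c j w → ReachSp i j
  walk-lift {u} here u∈H i j u∈Zi u∈Zj = Z-reach u u∈H i j u∈Zi u∈Zj
  walk-lift {u} (there {y = y} uy y∈H walk) u∈H i j u∈Zi w∈Zj
    with edge-touch u y u∈H y∈H (proj₁ (E⊆ H u y uy))
  ... | i′ , j′ , u∈Zi′ , y∈Zj′ , link = reach-++ (Z-reach u u∈H i i′ u∈Zi u∈Zi′) (cross link)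
    where
    cross : (i′ ≡ j′) ⊎ CycAdj i′ j′ → ReachSp i′ j
    cross (inj₁ refl) = walk-lift walk y∈H j′ j y∈Zj′ w∈Zj
    cross (inj₂ adj)  = there adj (y , y∈H , inj₁ y∈Zj′) (walk-lift walk y∈H j′ j y∈Zj′ w∈Zj)

  some-Z : ∀ u → InH u → Σ (Fin L) λ i → InZ G c i u
  some-Z u u∈H with proj₁ (V⊆ H u u∈H) | ∈C? u
  ... | inj₁ (i , ci≡u) | _              = i , inj₁ (sym ci≡u)
  ... | inj₂ _          | yes (k , ck≡u) = k , inj₁ (sym ck≡u)
  ... | inj₂ (i , u-ci) | no u∉C         = i , inj₂ (adj-symmetric G u-ci , u∉C , ∉D u∈H)

  -- a position of sp(H) is witnessed through a Z-set, since H avoids D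
  sp-witness : ∀ i → InSp G c H i → Σ (Fin n) λ u → InH u × InZ G c i u
  sp-witness i (u , u∈H , inj₁ u∈Zi) = u , u∈H , u∈Zi
  sp-witness i (u , u∈H , inj₂ u∈D)  = ⊥-elim (∉D u∈H u∈D)

  sp-connected : IsConnectedSub H → SpConnected G c H
  sp-connected ((u , u∈H) , connected) = (proj₁ (some-Z u u∈H) , u , u∈H , inj₁ (proj₂ (some-Z u u∈H))) , joined
    where
    joined : ∀ i j → InSp G c H i → InSp G c H j → ReachSp i j
    joined i j i∈sp j∈sp with sp-witness i i∈sp | sp-witness j j∈sp
    ... | v , v∈H , v∈Zi | w , w∈H , w∈Zj = walk-lift (connected v w v∈H w∈H) v∈H i j v∈Zi w∈Zj

lemma4p5 : ∀ {n : ℕ} (G : Graph n) (k : ℕ) (L : ℕ) (c : Fin L → Fin n)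
    → 1 ≤ k
    → IsShortestHole G L c
    → MuLt k L
    → ChordalMinus G c
    → (H : SubgraphOfGnbd G c)
    → IsConnectedSub H
    → SpConnected G c H
lemma4p5 G k L c k≥1 (hole , shortest) μ<L _ H H-connected =
  Neighbourhood.sp-connected G L {{>-nonZero (≤-trans (s≤s z≤n) L≥7)}} c hole shortest L≥7 H H-connected
  where
  L≥7 : 7 ≤ L
  L≥7 = Threshold.muLt⇒7≤L k L k≥1 μ<L
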